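{- Let $\mathbb{K}\in\{\mathbb{R},\mathbb{C}\}$, let $V$ be a finite-dimensional $\mathbb{K}$-vector space, let $r\ge1$, and let $a_1,\dots,a_m\in\mathbb{K}[\mathcal{S}_r]$. A tensor $T\in\mathcal{T}_rV$ satisfies the system of linear identities $a_iT=0$ ($i=1,\dots,m$) if and only if $T_b\in\mathfrak{l}:=\{x\in\mathbb{K}[\mathcal{S}_r]\mid x\cdot a_i^{\ast}=0 \text{ for } i=1,\dots,m\}$ for all $b\in V^r$, i.e. all $T_b$ of $T$ lie in the left annihilator ideal of the set $\{a_1^{\ast},\dots,a_m^{\ast}\}$.
   Context: $\mathcal{T}_rV$ denotes the space of $r$-times covariant tensors on $V$, i.e. multilinear maps $V^r\to\mathbb{K}$. $\mathcal{S}_r$ is the symmetric group on $\{1,\dots,r\}$ with product $(p\circ q)(i)=p(q(i))$, and $\mathbb{K}[\mathcal{S}_r]$ its group ring. An element $a=\sum_{p}a(p)\,p\in\mathbb{K}[\mathcal{S}_r]$ acts on tensors by $(aT)(v_1,\dots,v_r):=\sum_{p}a(p)\,T(v_{p(1)},\dots,v_{p(r)})$. The map $\ast$ is defined by $a^{\ast}:=\sum_p a(p)\,p^{ -1}$. For $T\in\mathcal{T}_rV$ and $b=(v_1,\dots,v_r)\in V^r$ (vectors may be linearly dependent or repeated), $T_b:=\sum_{p\in\mathcal{S}_r}T(v_{p(1)},\dots,v_{p(r)})\,p$. -}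

module Defs where

open import Level using (Level; _⊔_)
open import Algebra.Bundles using (CommutativeRing)
open import Data.Nat using (ℕ; zero; suc)
open import Data.Fin using (Fin; _≟_)
open import Data.Fin.Properties using (all?; any?)
open import Data.Vec using (Vec; []; _∷_; lookup; tabulate)
open import Data.Vec.Properties using (≡-dec)
open import Data.List using (List; [_]; map; concatMap; allFin; filter; foldr)
open import Data.Product using (Σ; ∃; _×_; _,_)
open import Relation.Binary.PropositionalEquality using (_≡_)
open import Relation.Nullary using (¬_; Dec; yes; no)
open import Relation.Nullary.Decidable using (_×-dec_; _→-dec_)

-- A map Fin r → Fin r is encoded by the vector of its values
-- (p ↦ (p(1),…,p(r))), which has decidable equality and can be
-- enumerated.

allVecs : (n r : ℕ) → List (Vec (Fin n) r)
allVecs n zero    = [ [] ]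
allVecs n (suc r) = concatMap (λ i → map (i ∷_) (allVecs n r)) (allFin n)

IsPerm : {r : ℕ} → Vec (Fin r) r → Set
IsPerm {r} p = (∀ i j → lookup p i ≡ lookup p j → i ≡ j)
             × (∀ j → ∃ λ i → lookup p i ≡ j)

isPerm? : {r : ℕ} → (p : Vec (Fin r) r) → Dec (IsPerm p)
isPerm? p =
  all? (λ i → all? (λ j → (lookup p i ≟ lookup p j) →-dec (i ≟ j)))
  ×-dec all? (λ j → any? (λ i → lookup p i ≟ j))

Sym : (r : ℕ) → List (Vec (Fin r) r)
Sym r = filter isPerm? (allVecs r r)

_∘ₚ_ : {r : ℕ} → Vec (Fin r) r → Vec (Fin r) r → Vec (Fin r) r
p ∘ₚ q = tabulate (λ i → lookup p (lookup q i))

idₚ : {r : ℕ} → Vec (Fin r) r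
idₚ = tabulate (λ i → i)

_≟ₚ_ : {r : ℕ} → (p q : Vec (Fin r) r) → Dec (p ≡ q)
_≟ₚ_ = ≡-dec _≟_

module OverRing {c ℓ : Level} (K : CommutativeRing c ℓ) where
  open CommutativeRing K renaming (Carrier to 𝕂)

  IsField : Set (c ⊔ ℓ)
  IsField = (¬ (1# ≈ 0#)) × (∀ x → ¬ (x ≈ 0#) → ∃ λ y → x * y ≈ 1#)

  Σ[_]_ : {A : Set} → List A → (A → 𝕂) → 𝕂
  Σ[ xs ] f = foldr (λ x s → f x + s) 0# xs

  -- group ring K[S_r]: coefficient function a(p) for p ∈ S_r
  -- (values on non-permutation vectors are irrelevant)
  GroupRing : ℕ → Set c
  GroupRing r = Vec (Fin r) r → 𝕂

  ind : {A : Set} → Dec A → 𝕂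
  ind (yes _) = 1#
  ind (no _)  = 0#

  _·_ : {r : ℕ} → GroupRing r → GroupRing r → GroupRing r
  _·_ {r} x y q = Σ[ Sym r ] λ p → Σ[ Sym r ] λ s → ind ((p ∘ₚ s) ≟ₚ q) * (x p * y s)

  -- a* = Σ a(p) p⁻¹, i.e. a*(q) = a(q⁻¹) = Σ_{p ∘ q = id} a(p)
  _* : {r : ℕ} → GroupRing r → GroupRing r
  _* {r} a q = Σ[ Sym r ] λ p → ind ((p ∘ₚ q) ≟ₚ idₚ) * a p

  IsZero : {r : ℕ} → GroupRing r → Set ℓ
  IsZero {r} x = ∀ p → IsPerm p → x p ≈ 0#

  Vect : ℕ → Set c
  Vect n = Fin n → 𝕂

  _⊕_ : {n : ℕ} → Vect n → Vect n → Vect n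
  (u ⊕ w) k = u k + w k

  _⊙_ : {n : ℕ} → 𝕂 → Vect n → Vect n
  (λ′ ⊙ u) k = λ′ * u k

  setArg : {n r : ℕ} → (Fin r → Vect n) → Fin r → Vect n → (Fin r → Vect n)
  setArg v i u j with i ≟ j
  ... | yes _ = u
  ... | no  _ = v j

  -- r-times covariant tensors: multilinear maps V^r → K
  IsMultilinear : {n r : ℕ} → ((Fin r → Vect n) → 𝕂) → Set (c ⊔ ℓ)
  IsMultilinear {n} {r} T =
    (∀ v w → (∀ i k → v i k ≈ w i k) → T v ≈ T w)
    × (∀ v i (λ′ : 𝕂) (u w : Vect n) →
         T (setArg v i ((λ′ ⊙ u) ⊕ w)) ≈ (λ′ * T (setArg v i u)) + T (setArg v i w))

  permuteArgs : {n r : ℕ} → Vec (Fin r) r → (Fin r → Vect n) → (Fin r → Vect n)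
  permuteArgs p v i = v (lookup p i)

  act : {n r : ℕ} → GroupRing r → ((Fin r → Vect n) → 𝕂) → ((Fin r → Vect n) → 𝕂)
  act {r = r} a T v = Σ[ Sym r ] λ p → a p * T (permuteArgs p v)

  Tb : {n r : ℕ} → ((Fin r → Vect n) → 𝕂) → (Fin r → Vect n) → GroupRing r
  Tb T b p = T (permuteArgs p b)

{-# OPTIONS --safe #-}
-- For every permutation q one has (T_b · a*)(q) = (aT)(b ∘ q), where b ∘ q = (v_{q(1)},…,v_{q(r)}).
-- Expanding a* and the product turns the left side into a triple sum over p, s, t ∈ S_r of
-- [p s = q] [t s = 1] T(b ∘ p) a(t); the two Kronecker deltas force s = t⁻¹ and p = q t, leaving
-- Σ_t a(t) T(b ∘ q t). Since b ↦ b ∘ q is onto V^r (take q = 1), all T_b lie in the left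
-- annihilator of the a_i* exactly when all a_i T vanish.
module Submission where

open import Defs
open import Level using (Level)
open import Algebra.Bundles using (CommutativeRing)
open import Data.Nat using (ℕ; _≥_; zero; suc)
open import Data.Fin using (Fin; zero; suc; _≟_)
open import Data.Fin.Properties using (suc-injective)
open import Data.Product using (_×_; _,_; proj₁; proj₂)
open import Data.Vec using (Vec; []; _∷_; lookup; tabulate)
open import Data.Vec.Properties using (lookup∘tabulate; tabulate∘lookup; tabulate-cong; ∷-injective; ≡-dec)
open import Data.List using (List; []; _∷_; map; concatMap; allFin; filter; _++_)
open import Data.List.Properties using (map-tabulate)
open import Data.List.Relation.Unary.All using (All; []; _∷_)
open import Data.List.Relation.Unary.All.Properties using (all-filter)
open import Relation.Binary.PropositionalEquality as ≡ using (_≡_)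
open import Relation.Nullary using (¬_; Dec; yes; no)
open import Data.Empty using (⊥-elim)

Perm : ℕ → Set
Perm r = Vec (Fin r) r

module _ {r : ℕ} where
  open ≡.≡-Reasoning

  lookup-ext : {u v : Perm r} → (∀ i → lookup u i ≡ lookup v i) → u ≡ v
  lookup-ext {u} {v} u≗v = ≡.trans (≡.sym (tabulate∘lookup u)) (≡.trans (tabulate-cong u≗v) (tabulate∘lookup v))

  lookup-∘ₚ : (p q : Perm r) (i : Fin r) → lookup (p ∘ₚ q) i ≡ lookup p (lookup q i)
  lookup-∘ₚ p q = lookup∘tabulate _

  lookup-idₚ : (i : Fin r) → lookup idₚ i ≡ i
  lookup-idₚ = lookup∘tabulate _

  ∘ₚ-assoc : (p q s : Perm r) → (p ∘ₚ q) ∘ₚ s ≡ p ∘ₚ (q ∘ₚ s)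
  ∘ₚ-assoc p q s = lookup-ext λ i → begin
    lookup ((p ∘ₚ q) ∘ₚ s) i         ≡⟨ lookup-∘ₚ (p ∘ₚ q) s i ⟩
    lookup (p ∘ₚ q) (lookup s i)     ≡⟨ lookup-∘ₚ p q (lookup s i) ⟩
    lookup p (lookup q (lookup s i)) ≡⟨ ≡.cong (lookup p) (lookup-∘ₚ q s i) ⟨
    lookup p (lookup (q ∘ₚ s) i)     ≡⟨ lookup-∘ₚ p (q ∘ₚ s) i ⟨
    lookup (p ∘ₚ (q ∘ₚ s)) i         ∎

  ∘ₚ-identityʳ : (p : Perm r) → p ∘ₚ idₚ ≡ p
  ∘ₚ-identityʳ p = lookup-ext λ i → ≡.trans (lookup∘tabulate _ i) (≡.cong (lookup p) (lookup-idₚ i))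

  ∘ₚ-cancelˡ : (t : Perm r) {s s′ : Perm r} → IsPerm t → t ∘ₚ s ≡ t ∘ₚ s′ → s ≡ s′
  ∘ₚ-cancelˡ t {s} {s′} (t-inj , _) ts≡ts′ = lookup-ext λ i → t-inj _ _ (begin
    lookup t (lookup s i)  ≡⟨ lookup-∘ₚ t s i ⟨
    lookup (t ∘ₚ s) i      ≡⟨ ≡.cong (λ u → lookup u i) ts≡ts′ ⟩
    lookup (t ∘ₚ s′) i     ≡⟨ lookup-∘ₚ t s′ i ⟩
    lookup t (lookup s′ i) ∎)

  inverse : (t : Perm r) → IsPerm t → Perm r
  inverse t (_ , t-surj) = tabulate (λ j → proj₁ (t-surj j))

  lookup-inverseʳ : (t : Perm r) (t-perm : IsPerm t) (j : Fin r) → lookup t (lookup (inverse t t-perm) j) ≡ j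
  lookup-inverseʳ t (_ , t-surj) j = ≡.trans (≡.cong (lookup t) (lookup∘tabulate _ j)) (proj₂ (t-surj j))

  lookup-inverseˡ : (t : Perm r) (t-perm : IsPerm t) (i : Fin r) → lookup (inverse t t-perm) (lookup t i) ≡ i
  lookup-inverseˡ t t-perm i = proj₁ t-perm _ _ (lookup-inverseʳ t t-perm (lookup t i))

  ∘ₚ-inverseʳ : (t : Perm r) (t-perm : IsPerm t) → t ∘ₚ inverse t t-perm ≡ idₚ
  ∘ₚ-inverseʳ t t-perm = lookup-ext λ j →
    ≡.trans (lookup-∘ₚ t (inverse t t-perm) j) (≡.trans (lookup-inverseʳ t t-perm j) (≡.sym (lookup-idₚ j)))

  ∘ₚ-inverseˡ : (t : Perm r) (t-perm : IsPerm t) → inverse t t-perm ∘ₚ t ≡ idₚ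
  ∘ₚ-inverseˡ t t-perm = lookup-ext λ i →
    ≡.trans (lookup-∘ₚ (inverse t t-perm) t i) (≡.trans (lookup-inverseˡ t t-perm i) (≡.sym (lookup-idₚ i)))

  idₚ-isPerm : IsPerm (idₚ {r})
  idₚ-isPerm = (λ i j e → ≡.trans (≡.sym (lookup-idₚ i)) (≡.trans e (lookup-idₚ j))) , (λ j → j , lookup-idₚ j)

  ∘ₚ-isPerm : (p q : Perm r) → IsPerm p → IsPerm q → IsPerm (p ∘ₚ q)
  ∘ₚ-isPerm p q (p-inj , p-surj) (q-inj , q-surj) =
    (λ i j e → q-inj _ _ (p-inj _ _ (≡.trans (≡.sym (lookup-∘ₚ p q i)) (≡.trans e (lookup-∘ₚ p q j))))) ,
    λ k → let (j , pj≡k) = p-surj k ; (i , qi≡j) = q-surj j in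
      i , ≡.trans (lookup-∘ₚ p q i) (≡.trans (≡.cong (lookup p) qi≡j) pj≡k)

  inverse-isPerm : (t : Perm r) (t-perm : IsPerm t) → IsPerm (inverse t t-perm)
  inverse-isPerm t t-perm =
    (λ i j e → ≡.trans (≡.sym (lookup-inverseʳ t t-perm i)) (≡.trans (≡.cong (lookup t) e) (lookup-inverseʳ t t-perm j))) ,
    (λ i → lookup t i , lookup-inverseˡ t t-perm i)

  ∘ₚ≡idₚ⇒≡inverse : (t : Perm r) {s : Perm r} (t-perm : IsPerm t) → t ∘ₚ s ≡ idₚ → s ≡ inverse t t-perm
  ∘ₚ≡idₚ⇒≡inverse t t-perm ts≡id = ∘ₚ-cancelˡ t t-perm (≡.trans ts≡id (≡.sym (∘ₚ-inverseʳ t t-perm)))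

  ∘ₚinverse≡⇒≡∘ₚ : (t : Perm r) {p q : Perm r} (t-perm : IsPerm t) → p ∘ₚ inverse t t-perm ≡ q → p ≡ q ∘ₚ t
  ∘ₚinverse≡⇒≡∘ₚ t {p} {q} t-perm pt⁻¹≡q = begin
    p                                ≡⟨ ∘ₚ-identityʳ p ⟨
    p ∘ₚ idₚ                         ≡⟨ ≡.cong (p ∘ₚ_) (∘ₚ-inverseˡ t t-perm) ⟨
    p ∘ₚ (inverse t t-perm ∘ₚ t)     ≡⟨ ∘ₚ-assoc p (inverse t t-perm) t ⟨
    (p ∘ₚ inverse t t-perm) ∘ₚ t     ≡⟨ ≡.cong (_∘ₚ t) pt⁻¹≡q ⟩
    q ∘ₚ t                           ∎

  ∘ₚ-inverse-cancelʳ : (q t : Perm r) (t-perm : IsPerm t) → (q ∘ₚ t) ∘ₚ inverse t t-perm ≡ q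
  ∘ₚ-inverse-cancelʳ q t t-perm = begin
    (q ∘ₚ t) ∘ₚ inverse t t-perm ≡⟨ ∘ₚ-assoc q t (inverse t t-perm) ⟩
    q ∘ₚ (t ∘ₚ inverse t t-perm) ≡⟨ ≡.cong (q ∘ₚ_) (∘ₚ-inverseʳ t t-perm) ⟩
    q ∘ₚ idₚ                     ≡⟨ ∘ₚ-identityʳ q ⟩
    q                            ∎

module _ {c ℓ : Level} (K : CommutativeRing c ℓ) where
  open CommutativeRing K hiding (zero) renaming (Carrier to 𝕂)
  open OverRing K
  open import Relation.Binary.Reasoning.Setoid setoid

  ind-yes : {A : Set} → A → (A? : Dec A) → ind A? ≈ 1#
  ind-yes a (yes _) = refl
  ind-yes a (no ¬a) = ⊥-elim (¬a a)

  ind-no : {A : Set} → ¬ A → (A? : Dec A) → ind A? ≈ 0#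
  ind-no ¬a (yes a) = ⊥-elim (¬a a)
  ind-no ¬a (no _)  = refl

  ind-cong : {A B : Set} → (A → B) → (B → A) → (A? : Dec A) (B? : Dec B) → ind A? ≈ ind B?
  ind-cong A→B B→A (yes a) B? = sym (ind-yes (A→B a) B?)
  ind-cong A→B B→A (no ¬a) B? = sym (ind-no (λ b → ¬a (B→A b)) B?)

  ind-× : {A B C : Set} → (C → A × B) → (A → B → C) → (C? : Dec C) (A? : Dec A) (B? : Dec B) →
          ind C? ≈ ind A? * ind B?
  ind-× C→A×B A→B→C C? (yes a) (yes b) = trans (ind-yes (A→B→C a b) C?) (sym (*-identityˡ 1#))
  ind-× C→A×B A→B→C C? (yes a) (no ¬b) = trans (ind-no (λ c → ¬b (proj₂ (C→A×B c))) C?) (sym (*-identityˡ 0#))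
  ind-× C→A×B A→B→C C? (no ¬a) B?      = trans (ind-no (λ c → ¬a (proj₁ (C→A×B c))) C?) (sym (zeroˡ (ind B?)))

  *-swapˡ : ∀ x y z → x * (y * z) ≈ y * (x * z)
  *-swapˡ x y z = begin
    x * (y * z) ≈⟨ *-assoc x y z ⟨
    (x * y) * z ≈⟨ *-congʳ (*-comm x y) ⟩
    (y * x) * z ≈⟨ *-assoc y x z ⟩
    y * (x * z) ∎

  +-interchange : ∀ w x y z → (w + x) + (y + z) ≈ (w + y) + (x + z)
  +-interchange w x y z = begin
    (w + x) + (y + z) ≈⟨ +-assoc w x (y + z) ⟩
    w + (x + (y + z)) ≈⟨ +-congˡ (+-assoc x y z) ⟨
    w + ((x + y) + z) ≈⟨ +-congˡ (+-congʳ (+-comm x y)) ⟩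
    w + ((y + x) + z) ≈⟨ +-congˡ (+-assoc y x z) ⟩
    w + (y + (x + z)) ≈⟨ +-assoc w y (x + z) ⟨
    (w + y) + (x + z) ∎

  Σ-cong : {A : Set} (xs : List A) {f g : A → 𝕂} → (∀ x → f x ≈ g x) → Σ[ xs ] f ≈ Σ[ xs ] g
  Σ-cong []       f≈g = refl
  Σ-cong (x ∷ xs) f≈g = +-cong (f≈g x) (Σ-cong xs f≈g)

  Σ-cong-All : {A : Set} {P : A → Set} {xs : List A} {f g : A → 𝕂} →
               All P xs → (∀ x → P x → f x ≈ g x) → Σ[ xs ] f ≈ Σ[ xs ] g
  Σ-cong-All []         f≈g = refl
  Σ-cong-All (px ∷ pxs) f≈g = +-cong (f≈g _ px) (Σ-cong-All pxs f≈g)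

  Σ-zero : {A : Set} (xs : List A) → Σ[ xs ] (λ _ → 0#) ≈ 0#
  Σ-zero []       = refl
  Σ-zero (x ∷ xs) = trans (+-identityˡ _) (Σ-zero xs)

  Σ-distrib-+ : {A : Set} (xs : List A) (f g : A → 𝕂) → Σ[ xs ] (λ x → f x + g x) ≈ Σ[ xs ] f + Σ[ xs ] g
  Σ-distrib-+ []       f g = sym (+-identityˡ 0#)
  Σ-distrib-+ (x ∷ xs) f g = trans (+-congˡ (Σ-distrib-+ xs f g)) (+-interchange _ _ _ _)

  Σ-swap : {A B : Set} (xs : List A) (ys : List B) (f : A → B → 𝕂) →
           Σ[ xs ] (λ x → Σ[ ys ] (f x)) ≈ Σ[ ys ] (λ y → Σ[ xs ] (λ x → f x y))
  Σ-swap []       ys f = sym (Σ-zero ys)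
  Σ-swap (x ∷ xs) ys f =
    trans (+-congˡ (Σ-swap xs ys f)) (sym (Σ-distrib-+ ys (f x) (λ y → Σ[ xs ] (λ x → f x y))))

  *-distribˡ-Σ : {A : Set} (xs : List A) (z : 𝕂) (f : A → 𝕂) → z * Σ[ xs ] f ≈ Σ[ xs ] (λ x → z * f x)
  *-distribˡ-Σ []       z f = zeroʳ z
  *-distribˡ-Σ (x ∷ xs) z f = trans (distribˡ z (f x) _) (+-congˡ (*-distribˡ-Σ xs z f))

  Σ-++ : {A : Set} (xs ys : List A) (f : A → 𝕂) → Σ[ xs ++ ys ] f ≈ Σ[ xs ] f + Σ[ ys ] f
  Σ-++ []       ys f = sym (+-identityˡ _)
  Σ-++ (x ∷ xs) ys f = trans (+-congˡ (Σ-++ xs ys f)) (sym (+-assoc _ _ _))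

  Σ-map : {A B : Set} (g : A → B) (xs : List A) (f : B → 𝕂) → Σ[ map g xs ] f ≡ Σ[ xs ] (λ x → f (g x))
  Σ-map g []       f = ≡.refl
  Σ-map g (x ∷ xs) f = ≡.cong (f (g x) +_) (Σ-map g xs f)

  Σ-concatMap : {A B : Set} (g : A → List B) (xs : List A) (f : B → 𝕂) →
                Σ[ concatMap g xs ] f ≈ Σ[ xs ] (λ x → Σ[ g x ] f)
  Σ-concatMap g []       f = refl
  Σ-concatMap g (x ∷ xs) f = trans (Σ-++ (g x) (concatMap g xs) f) (+-congˡ (Σ-concatMap g xs f))

  Σ-filter : {A : Set} {P : A → Set} (P? : ∀ x → Dec (P x)) (xs : List A) (f : A → 𝕂) →
             Σ[ filter P? xs ] f ≈ Σ[ xs ] (λ x → ind (P? x) * f x)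
  Σ-filter P? []       f = refl
  Σ-filter P? (x ∷ xs) f with P? x
  ... | yes _ = +-cong (sym (*-identityˡ _)) (Σ-filter P? xs f)
  ... | no  _ = trans (sym (+-identityˡ _)) (+-cong (sym (zeroˡ _)) (Σ-filter P? xs f))

  Σ-allFin-suc : {n : ℕ} (f : Fin (suc n) → 𝕂) → Σ[ allFin (suc n) ] f ≡ f zero + Σ[ allFin n ] (λ i → f (suc i))
  Σ-allFin-suc {n} f = ≡.cong (f zero +_)
    (≡.trans (≡.cong (Σ[_] f) (≡.sym (map-tabulate (λ i → i) suc))) (Σ-map suc (allFin n) f))

  Σ-allFin-δ : (n : ℕ) (h : Fin n → 𝕂) (j : Fin n) → Σ[ allFin n ] (λ i → ind (i ≟ j) * h i) ≈ h j
  Σ-allFin-δ (suc n) h zero = begin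
    Σ[ allFin (suc n) ] (λ i → ind (i ≟ zero) * h i)                 ≡⟨ Σ-allFin-suc (λ i → ind (i ≟ zero) * h i) ⟩
    1# * h zero + Σ[ allFin n ] (λ i → 0# * h (suc i))               ≈⟨ +-cong (*-identityˡ _) (Σ-cong (allFin n) (λ i → zeroˡ _)) ⟩
    h zero + Σ[ allFin n ] (λ _ → 0#)                                 ≈⟨ +-congˡ (Σ-zero (allFin n)) ⟩
    h zero + 0#                                                       ≈⟨ +-identityʳ _ ⟩
    h zero                                                            ∎
  Σ-allFin-δ (suc n) h (suc j) = begin
    Σ[ allFin (suc n) ] (λ i → ind (i ≟ suc j) * h i)                ≡⟨ Σ-allFin-suc (λ i → ind (i ≟ suc j) * h i) ⟩
    0# * h zero + Σ[ allFin n ] (λ i → ind (suc i ≟ suc j) * h (suc i))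
      ≈⟨ +-cong (zeroˡ _) (Σ-cong (allFin n) λ i → *-congʳ (ind-cong suc-injective (≡.cong suc) (suc i ≟ suc j) (i ≟ j))) ⟩
    0# + Σ[ allFin n ] (λ i → ind (i ≟ j) * h (suc i))               ≈⟨ +-identityˡ _ ⟩
    Σ[ allFin n ] (λ i → ind (i ≟ j) * h (suc i))                    ≈⟨ Σ-allFin-δ n (λ i → h (suc i)) j ⟩
    h (suc j)                                                         ∎

  Σ-allVecs-suc : (n r : ℕ) (f : Vec (Fin n) (suc r) → 𝕂) →
                  Σ[ allVecs n (suc r) ] f ≈ Σ[ allFin n ] (λ i → Σ[ allVecs n r ] (λ p → f (i ∷ p)))
  Σ-allVecs-suc n r f = trans (Σ-concatMap (λ i → map (i ∷_) (allVecs n r)) (allFin n) f)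
                              (Σ-cong (allFin n) (λ i → reflexive (Σ-map (i ∷_) (allVecs n r) f)))

  ind-∷ : {n r : ℕ} (i j : Fin n) (p q : Vec (Fin n) r) →
          ind (≡-dec _≟_ (i ∷ p) (j ∷ q)) ≈ ind (i ≟ j) * ind (≡-dec _≟_ p q)
  ind-∷ i j p q = ind-× ∷-injective (≡.cong₂ _∷_) (≡-dec _≟_ (i ∷ p) (j ∷ q)) (i ≟ j) (≡-dec _≟_ p q)

  Σ-allVecs-δ : (n r : ℕ) (q : Vec (Fin n) r) (g : Vec (Fin n) r → 𝕂) →
                Σ[ allVecs n r ] (λ p → ind (≡-dec _≟_ p q) * g p) ≈ g q
  Σ-allVecs-δ n zero    []      g = trans (+-identityʳ _) (*-identityˡ (g []))
  Σ-allVecs-δ n (suc r) (j ∷ q) g = begin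
    Σ[ allVecs n (suc r) ] (λ p → ind (≡-dec _≟_ p (j ∷ q)) * g p)
      ≈⟨ Σ-allVecs-suc n r _ ⟩
    Σ[ allFin n ] (λ i → Σ[ allVecs n r ] (λ p → ind (≡-dec _≟_ (i ∷ p) (j ∷ q)) * g (i ∷ p)))
      ≈⟨ Σ-cong (allFin n) (λ i → Σ-cong (allVecs n r) (λ p → trans (*-congʳ (ind-∷ i j p q)) (*-assoc _ _ _))) ⟩
    Σ[ allFin n ] (λ i → Σ[ allVecs n r ] (λ p → ind (i ≟ j) * (ind (≡-dec _≟_ p q) * g (i ∷ p))))
      ≈⟨ Σ-cong (allFin n) (λ i → sym (*-distribˡ-Σ (allVecs n r) (ind (i ≟ j)) _)) ⟩
    Σ[ allFin n ] (λ i → ind (i ≟ j) * Σ[ allVecs n r ] (λ p → ind (≡-dec _≟_ p q) * g (i ∷ p)))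
      ≈⟨ Σ-cong (allFin n) (λ i → *-congˡ (Σ-allVecs-δ n r q (λ p → g (i ∷ p)))) ⟩
    Σ[ allFin n ] (λ i → ind (i ≟ j) * g (i ∷ q))
      ≈⟨ Σ-allFin-δ n (λ i → g (i ∷ q)) j ⟩
    g (j ∷ q) ∎

  Σ-Sym-cong : {r : ℕ} {f g : Perm r → 𝕂} → (∀ p → IsPerm p → f p ≈ g p) → Σ[ Sym r ] f ≈ Σ[ Sym r ] g
  Σ-Sym-cong {r} = Σ-cong-All (all-filter isPerm? (allVecs r r))

  Σ-Sym-δ : {r : ℕ} (q : Perm r) → IsPerm q → (g : Perm r → 𝕂) → Σ[ Sym r ] (λ p → ind (p ≟ₚ q) * g p) ≈ g q
  Σ-Sym-δ {r} q q-perm g = begin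
    Σ[ Sym r ] (λ p → ind (p ≟ₚ q) * g p)                              ≈⟨ Σ-filter isPerm? (allVecs r r) _ ⟩
    Σ[ allVecs r r ] (λ p → ind (isPerm? p) * (ind (p ≟ₚ q) * g p))    ≈⟨ Σ-cong (allVecs r r) (λ p → *-swapˡ _ _ _) ⟩
    Σ[ allVecs r r ] (λ p → ind (p ≟ₚ q) * (ind (isPerm? p) * g p))    ≈⟨ Σ-allVecs-δ r r q _ ⟩
    ind (isPerm? q) * g q                                               ≈⟨ *-congʳ (ind-yes q-perm (isPerm? q)) ⟩
    1# * g q                                                            ≈⟨ *-identityˡ _ ⟩
    g q                                                                 ∎

  Σ-Sym-unique : {r : ℕ} {Q : Perm r → Set} (Q? : ∀ p → Dec (Q p)) (p₀ : Perm r) → IsPerm p₀ → Q p₀ →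
                 (∀ p → IsPerm p → Q p → p ≡ p₀) → (g : Perm r → 𝕂) →
                 Σ[ Sym r ] (λ p → ind (Q? p) * g p) ≈ g p₀
  Σ-Sym-unique {Q = Q} Q? p₀ p₀-perm Qp₀ unique g = trans
    (Σ-Sym-cong λ p p-perm → *-congʳ (ind-cong (unique p p-perm) (λ p≡p₀ → ≡.subst Q (≡.sym p≡p₀) Qp₀) (Q? p) (p ≟ₚ p₀)))
    (Σ-Sym-δ p₀ p₀-perm g)

  module _ {n r : ℕ} (T : (Fin r → Vect n) → 𝕂) (T-cong : ∀ v w → (∀ i k → v i k ≈ w i k) → T v ≈ T w) where

    T-cong-≡ : {v w : Fin r → Vect n} → (∀ i → v i ≡ w i) → T v ≈ T w
    T-cong-≡ v≗w = T-cong _ _ λ i k → reflexive (≡.cong (λ u → u k) (v≗w i))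

    act-cong : (a : GroupRing r) {v w : Fin r → Vect n} → (∀ i → v i ≡ w i) → act a T v ≈ act a T w
    act-cong a v≗w = Σ-cong (Sym r) λ p → *-congˡ (T-cong-≡ λ i → v≗w (lookup p i))

    Tb·a*≈act : (a : GroupRing r) (b : Fin r → Vect n) (q : Perm r) → IsPerm q →
                (Tb T b · (a *)) q ≈ act a T (permuteArgs q b)
    Tb·a*≈act a b q q-perm = begin
      (Tb T b · (a *)) q
        ≈⟨ Σ-cong (Sym r) (λ p → Σ-cong (Sym r) λ s →
             trans (*-congˡ (*-distribˡ-Σ (Sym r) (Tb T b p) _)) (*-distribˡ-Σ (Sym r) _ _)) ⟩
      Σ[ Sym r ] (λ p → Σ[ Sym r ] λ s → Σ[ Sym r ] λ t → F p s t)
        ≈⟨ Σ-cong (Sym r) (λ p → Σ-swap (Sym r) (Sym r) (F p)) ⟩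
      Σ[ Sym r ] (λ p → Σ[ Sym r ] λ t → Σ[ Sym r ] λ s → F p s t)
        ≈⟨ Σ-swap (Sym r) (Sym r) (λ p t → Σ[ Sym r ] λ s → F p s t) ⟩
      Σ[ Sym r ] (λ t → Σ[ Sym r ] λ p → Σ[ Sym r ] λ s → F p s t)
        ≈⟨ Σ-Sym-cong collapse ⟩
      act a T (permuteArgs q b) ∎
      where
      F : Perm r → Perm r → Perm r → 𝕂
      F p s t = ind ((p ∘ₚ s) ≟ₚ q) * (Tb T b p * (ind ((t ∘ₚ s) ≟ₚ idₚ) * a t))

      collapse : ∀ t → IsPerm t → Σ[ Sym r ] (λ p → Σ[ Sym r ] λ s → F p s t) ≈ a t * T (permuteArgs t (permuteArgs q b))
      collapse t t-perm = begin
        Σ[ Sym r ] (λ p → Σ[ Sym r ] λ s → F p s t)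
          ≈⟨ Σ-cong (Sym r) (λ p → Σ-cong (Sym r) λ s → trans (*-congˡ (*-swapˡ _ _ _)) (*-swapˡ _ _ _)) ⟩
        Σ[ Sym r ] (λ p → Σ[ Sym r ] λ s → ind ((t ∘ₚ s) ≟ₚ idₚ) * (ind ((p ∘ₚ s) ≟ₚ q) * (Tb T b p * a t)))
          ≈⟨ Σ-cong (Sym r) (λ p → Σ-Sym-unique (λ s → (t ∘ₚ s) ≟ₚ idₚ) t⁻¹ (inverse-isPerm t t-perm)
               (∘ₚ-inverseʳ t t-perm) (λ s _ → ∘ₚ≡idₚ⇒≡inverse t t-perm) _) ⟩
        Σ[ Sym r ] (λ p → ind ((p ∘ₚ t⁻¹) ≟ₚ q) * (Tb T b p * a t))
          ≈⟨ Σ-Sym-unique (λ p → (p ∘ₚ t⁻¹) ≟ₚ q) (q ∘ₚ t) (∘ₚ-isPerm q t q-perm t-perm)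
               (∘ₚ-inverse-cancelʳ q t t-perm) (λ p _ → ∘ₚinverse≡⇒≡∘ₚ t t-perm) _ ⟩
        Tb T b (q ∘ₚ t) * a t
          ≈⟨ *-comm _ _ ⟩
        a t * T (permuteArgs (q ∘ₚ t) b)
          ≈⟨ *-congˡ (T-cong-≡ λ i → ≡.cong b (lookup-∘ₚ q t i)) ⟩
        a t * T (permuteArgs t (permuteArgs q b)) ∎
        where
        t⁻¹ : Perm r
        t⁻¹ = inverse t t-perm

proposition2p5 : {c ℓ : Level} (K : CommutativeRing c ℓ) → OverRing.IsField K →
    (n r : ℕ) → r ≥ 1 → (m : ℕ) → (a : Fin m → OverRing.GroupRing K r) →
    (T : (Fin r → OverRing.Vect K n) → CommutativeRing.Carrier K) → OverRing.IsMultilinear K T →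
    ((∀ i → ∀ v → CommutativeRing._≈_ K (OverRing.act K (a i) T v) (CommutativeRing.0# K))
      → (∀ b → ∀ i → OverRing.IsZero K (OverRing._·_ K (OverRing.Tb K T b) (OverRing._* K (a i)))))
    × ((∀ b → ∀ i → OverRing.IsZero K (OverRing._·_ K (OverRing.Tb K T b) (OverRing._* K (a i))))
      → (∀ i → ∀ v → CommutativeRing._≈_ K (OverRing.act K (a i) T v) (CommutativeRing.0# K)))
proposition2p5 K _ n r _ m a T (T-cong , _) =
  (λ aT≈0 b i q q-perm → trans (Tb·a*≈act K T T-cong (a i) b q q-perm) (aT≈0 i (permuteArgs q b))) ,
  λ Tb·a*≈0 i v → begin
    act (a i) T v                         ≈⟨ act-cong K T T-cong (a i) (λ j → ≡.cong v (≡.sym (lookup-idₚ j))) ⟩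
    act (a i) T (permuteArgs idₚ v)       ≈⟨ Tb·a*≈act K T T-cong (a i) v idₚ idₚ-isPerm ⟨
    (Tb T v · (a i *)) idₚ                ≈⟨ Tb·a*≈0 v i idₚ idₚ-isPerm ⟩
    0#                                    ∎
  where
  open CommutativeRing K
  open OverRing K
  open import Relation.Binary.Reasoning.Setoid setoid
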